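{- For an integer $i\ge0$ write its base-$3$ digits least significant first, $(i)_3=i_0i_1i_2\dots$ (ending in infinitely many $0$'s). Define: (1) $w_i=1$ if the first digit different from $1$ in $(i)_3$ is $0$, and $w_i=-1$ if it is $2$ (equivalently, $w_i$ is the final state output of the automaton with states $a_0,a_1,a_2$, initial state $a_1$, outputs $1,1,-1$, where $a_1$ loops on $1$, goes to $a_0$ on $0$ and to $a_2$ on $2$, and $a_0,a_2$ are absorbing); (2) $a_i=3^m$, where $m$ is the number of initial $1$'s in $(i)_3$ (i.e. $(i)_3=1^m x\dots$ with $x\in\{0,2\}$); equivalently $a_i$ is the integer whose base-$3$ digits (least significant first) are $\sigma_1((i)_3)$, where $\sigma_1,\sigma_0$ are the transducer states with $\sigma_1(1w)=0\sigma_1(w)$, $\sigma_1(0w)=\sigma_1(2w)=1\sigma_0(w)$, and $\sigma_0$ rewrites every letter as $0$. Let $p_0=0$ and $p_n=\sum_{i=0}^{n-1}w_ia_i$ for $n\ge1$. Let $N_2$ be the set of non-negative integers whose base-$3$ representation uses only digits $0,1$, and let $\ell_n=\ell_n^++\ell_n^-$, where $\ell_n^\pm$ are the unique non-negative integers with $\ell_n^+,\ell_n^-,\ell_n^++\ell_n^-\in N_2$ and $n=\ell_n^+-\ell_n^-$. Then $p_n=\ell_n$ for all $n\ge0$. -}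

module Defs where

open import Data.Nat using (ℕ; zero; suc; _^_)
open import Data.Integer using (ℤ; +_; -_; _+_; _*_)
open import Data.Fin using (Fin; zero; suc)
open import Data.List using (List; []; _∷_)
open import Data.List.Relation.Unary.All using (All)
open import Data.Product using (proj₁)
open import Data.Digit using (toDigits; Digit)
open import Relation.Binary.PropositionalEquality using (_≡_; _≢_)

-- base-3 digits of i, least significant first (stdlib toDigits;
-- trailing zeros are implicit)
digits3 : ℕ → List (Digit 3)
digits3 i = proj₁ (toDigits 3 i)

-- w on a digit word: first digit different from 1 decides
-- (an exhausted word stands for the infinite tail of 0's)
wWord : List (Digit 3) → ℤ
wWord []                   = + 1
wWord (zero ∷ ds)          = + 1
wWord (suc zero ∷ ds)      = wWord ds
wWord (suc (suc zero) ∷ ds) = - (+ 1)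

initOnes : List (Digit 3) → ℕ
initOnes []               = 0
initOnes (suc zero ∷ ds)  = suc (initOnes ds)
initOnes (zero ∷ ds)      = 0
initOnes (suc (suc zero) ∷ ds) = 0

w : ℕ → ℤ
w i = wWord (digits3 i)

a : ℕ → ℤ
a i = + (3 ^ initOnes (digits3 i))

p : ℕ → ℤ
p zero    = + 0
p (suc n) = p n + w n * a n

N₂ : ℕ → Set
N₂ n = All (λ d → d ≢ suc (suc zero)) (digits3 n)

{-# OPTIONS --safe #-}
-- Both sides satisfy the same recursion on the last ternary digit of n. Since w and a only look
-- at the leading 1's of (i)₃, the terms of p group in blocks of three into p(3q) = 3 p(q),
-- p(3q+1) = 3 p(q) + 1 and p(3q+2) = 3 p(q+1) + 1. The conditions on l⁺ and l⁻ say that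
-- l⁺ − l⁻ is a balanced ternary expansion of n (digits ±1 at disjoint positions), whose last
-- digit is 0, +1 or −1 as n = 3q, 3q + 1 or 3(q+1) − 1; so l⁺ + l⁻ satisfies the same recursion.

module Submission where

open import Defs
open import Data.Nat using (ℕ; zero; suc; _+_; _*_; _^_; _<_; _%_; NonZero; z≤n; s≤s)
open import Data.Nat.Properties
  using ( +-cancelˡ-≡; *-cancelʳ-≡; *-distribʳ-+; +-suc; m+n≡0⇒m≡0; m+n≡0⇒n≡0
        ; m≤m*n; m<m*n; m≤n+m; ≤-trans)
open import Data.Nat.DivMod using (DivMod; _divMod_; [m+kn]%n≡m%n; m<n⇒m%n≡m)
open import Data.Nat.Induction using (Acc; acc; <-wellFounded)
open import Data.Nat.Tactic.RingSolver using (solve-∀)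
import Data.Integer as ℤ
import Data.Integer.Tactic.RingSolver as ℤ-Solver
open import Data.Integer using (ℤ; +_; -_)
open import Data.Integer.Properties using (pos-*; +-comm)
open import Data.Fin using (Fin; zero; suc; toℕ)
open import Data.Fin.Properties using (toℕ-injective; toℕ<n)
open import Data.Digit using (Digit; Expansion; toDigits; fromDigits)
open import Data.List using ([]; _∷_)
open import Data.List.Relation.Unary.All as All using (All; []; _∷_)
open import Data.Product using (Σ; _×_; _,_; proj₁; proj₂)
open import Data.Empty using (⊥-elim)
open import Relation.Binary.PropositionalEquality
  using (_≡_; _≢_; refl; sym; trans; cong; cong₂; subst; module ≡-Reasoning)

divMod-unique : ∀ {b} .{{_ : NonZero b}} (r s : Fin b) (x y : ℕ) →
                toℕ r + x * b ≡ toℕ s + y * b → r ≡ s × x ≡ y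
divMod-unique {b} r s x y eq = r≡s , *-cancelʳ-≡ x y b (+-cancelˡ-≡ (toℕ r) _ _ eq′)
  where
  digit≡% : ∀ (t : Fin b) z → (toℕ t + z * b) % b ≡ toℕ t
  digit≡% t z = trans ([m+kn]%n≡m%n (toℕ t) z b) (m<n⇒m%n≡m (toℕ<n t))

  r≡s : r ≡ s
  r≡s = toℕ-injective (trans (sym (digit≡% r x)) (trans (cong (_% b) eq) (digit≡% s y)))

  eq′ : toℕ r + x * b ≡ toℕ r + y * b
  eq′ = trans eq (cong (λ t → toℕ t + y * b) (sym r≡s))

data Ternary : ℕ → Set where
  _∷ᵗ_ : ∀ (d : Digit 3) q → Ternary (toℕ d + q * 3)

lastDigit : ∀ n → Ternary n
lastDigit n = subst Ternary (sym property) (remainder ∷ᵗ quotient)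
  where open DivMod (n divMod 3)

q<1+q*3 : ∀ q → q < suc (q * 3)
q<1+q*3 q = s≤s (m≤m*n q 3)

1+q<d+[1+q]*3 : ∀ (d : Digit 3) q → suc q < toℕ d + suc q * 3
1+q<d+[1+q]*3 d q = ≤-trans (m<m*n (suc q) 3 (s≤s (s≤s z≤n))) (m≤n+m _ (toℕ d))

Zeros : ∀ {b} → Expansion (suc b) → Set
Zeros = All (_≡ zero)

infix 4 _≈₀_
data _≈₀_ {b} : Expansion (suc b) → Expansion (suc b) → Set where
  zeros : ∀ {ds es} → Zeros ds → Zeros es → ds ≈₀ es
  _∷_   : ∀ d {ds es} → ds ≈₀ es → d ∷ ds ≈₀ d ∷ es

≈₀-sym : ∀ {b} {ds es : Expansion (suc b)} → ds ≈₀ es → es ≈₀ ds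
≈₀-sym (zeros zs zs′) = zeros zs′ zs
≈₀-sym (d ∷ eq)       = d ∷ ≈₀-sym eq

fromDigits≡0⇒Zeros : ∀ {b} (ds : Expansion (suc b)) → fromDigits ds ≡ 0 → Zeros ds
fromDigits≡0⇒Zeros []       _  = []
fromDigits≡0⇒Zeros (d ∷ ds) eq with divMod-unique d zero (fromDigits ds) 0 eq
... | refl , ds≡0 = refl ∷ fromDigits≡0⇒Zeros ds ds≡0

fromDigits-injective : ∀ {b} (ds es : Expansion (suc b)) →
                       fromDigits ds ≡ fromDigits es → ds ≈₀ es
fromDigits-injective []         es eq = zeros [] (fromDigits≡0⇒Zeros es (sym eq))
fromDigits-injective ds@(_ ∷ _) [] eq = zeros (fromDigits≡0⇒Zeros ds eq) []
fromDigits-injective (d ∷ ds) (e ∷ es) eq with divMod-unique d e _ _ eq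
... | refl , eq′ = d ∷ fromDigits-injective ds es eq′

-- toDigits 3 0 is [ 0 ] rather than [], so digits3 (d + q * 3) and d ∷ digits3 q agree only up to
-- trailing zeros.
digits3-∷ : ∀ (d : Digit 3) q → digits3 (toℕ d + q * 3) ≈₀ d ∷ digits3 q
digits3-∷ d q = fromDigits-injective _ _
  (trans (proj₂ (toDigits 3 _)) (cong (λ m → toℕ d + m * 3) (sym (proj₂ (toDigits 3 q)))))

wWord-≈₀ : ∀ {ds es : Expansion 3} → ds ≈₀ es → wWord ds ≡ wWord es
wWord-≈₀ (zeros zs zs′) = trans (ones zs) (sym (ones zs′))
  where
  ones : ∀ {ds} → Zeros ds → wWord ds ≡ + 1
  ones []         = refl
  ones (refl ∷ _) = refl
wWord-≈₀ (zero ∷ _)          = refl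
wWord-≈₀ (suc zero ∷ eq)     = wWord-≈₀ eq
wWord-≈₀ (suc (suc zero) ∷ _) = refl

initOnes-≈₀ : ∀ {ds es : Expansion 3} → ds ≈₀ es → initOnes ds ≡ initOnes es
initOnes-≈₀ (zeros zs zs′) = trans (none zs) (sym (none zs′))
  where
  none : ∀ {ds} → Zeros ds → initOnes ds ≡ 0
  none []         = refl
  none (refl ∷ _) = refl
initOnes-≈₀ (zero ∷ _)          = refl
initOnes-≈₀ (suc zero ∷ eq)     = cong suc (initOnes-≈₀ eq)
initOnes-≈₀ (suc (suc zero) ∷ _) = refl

noTwos-≈₀ : ∀ {ds es : Expansion 3} → ds ≈₀ es →
            All (_≢ suc (suc zero)) ds → All (_≢ suc (suc zero)) es
noTwos-≈₀ (zeros _ zs) _          = All.map (λ { refl () }) zs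
noTwos-≈₀ (d ∷ eq)     (d≢2 ∷ hs) = d≢2 ∷ noTwos-≈₀ eq hs

w-∷ : ∀ (d : Digit 3) q → w (toℕ d + q * 3) ≡ wWord (d ∷ digits3 q)
w-∷ d q = wWord-≈₀ (digits3-∷ d q)

a-∷ : ∀ (d : Digit 3) q → a (toℕ d + q * 3) ≡ + (3 ^ initOnes (d ∷ digits3 q))
a-∷ d q = cong (λ m → + (3 ^ m)) (initOnes-≈₀ (digits3-∷ d q))

N₂-uncons : ∀ (d : Digit 3) q → N₂ (toℕ d + q * 3) → d ≢ suc (suc zero) × N₂ q
N₂-uncons d q h = All.uncons (noTwos-≈₀ (digits3-∷ d q) h)

N₂-cons : ∀ (d : Digit 3) q → d ≢ suc (suc zero) → N₂ q → N₂ (toℕ d + q * 3)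
N₂-cons d q d≢2 hq = noTwos-≈₀ (≈₀-sym (digits3-∷ d q)) (d≢2 ∷ hq)

N₂-0 : N₂ 0
N₂-0 = (λ ()) ∷ []

w*a-×3 : ∀ q → w (q * 3) ℤ.* a (q * 3) ≡ + 1
w*a-×3 q = cong₂ ℤ._*_ (w-∷ zero q) (a-∷ zero q)

w*a-×3+1 : ∀ q → w (suc (q * 3)) ℤ.* a (suc (q * 3)) ≡ + 3 ℤ.* (w q ℤ.* a q)
w*a-×3+1 q = begin
  w (suc (q * 3)) ℤ.* a (suc (q * 3)) ≡⟨ cong₂ ℤ._*_ (w-∷ (suc zero) q) (a-∷ (suc zero) q) ⟩
  w q ℤ.* + (3 * 3 ^ m)               ≡⟨ cong (w q ℤ.*_) (pos-* 3 (3 ^ m)) ⟩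
  w q ℤ.* (+ 3 ℤ.* a q)               ≡⟨ swap (w q) (a q) ⟩
  + 3 ℤ.* (w q ℤ.* a q)               ∎
  where
  open ≡-Reasoning
  m = initOnes (digits3 q)
  swap : ∀ x y → x ℤ.* (+ 3 ℤ.* y) ≡ + 3 ℤ.* (x ℤ.* y)
  swap = ℤ-Solver.solve-∀

w*a-×3+2 : ∀ q → w (suc (suc (q * 3))) ℤ.* a (suc (suc (q * 3))) ≡ - + 1
w*a-×3+2 q = cong₂ ℤ._*_ (w-∷ (suc (suc zero)) q) (a-∷ (suc (suc zero)) q)

p-×3 : ∀ q → p (q * 3) ≡ p q ℤ.* + 3
p-×3 zero    = refl
p-×3 (suc q) = begin
  p (suc (suc (suc (q * 3))))
    ≡⟨ cong₂ ℤ._+_ (cong₂ ℤ._+_ (cong₂ ℤ._+_ (p-×3 q) (w*a-×3 q)) (w*a-×3+1 q)) (w*a-×3+2 q) ⟩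
  p q ℤ.* + 3 ℤ.+ + 1 ℤ.+ + 3 ℤ.* (w q ℤ.* a q) ℤ.+ - + 1
    ≡⟨ regroup (p q) (w q ℤ.* a q) ⟩
  p (suc q) ℤ.* + 3 ∎
  where
  open ≡-Reasoning
  regroup : ∀ x y → x ℤ.* + 3 ℤ.+ + 1 ℤ.+ + 3 ℤ.* y ℤ.+ - + 1 ≡ (x ℤ.+ y) ℤ.* + 3
  regroup = ℤ-Solver.solve-∀

p-×3+1 : ∀ q → p (suc (q * 3)) ≡ + 1 ℤ.+ p q ℤ.* + 3
p-×3+1 q = trans (cong₂ ℤ._+_ (p-×3 q) (w*a-×3 q)) (+-comm (p q ℤ.* + 3) (+ 1))

p-×3+2 : ∀ q → p (suc (suc (q * 3))) ≡ + 1 ℤ.+ p (suc q) ℤ.* + 3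
p-×3+2 q = trans (cong₂ ℤ._+_ (p-×3+1 q) (w*a-×3+1 q)) (regroup (p q) (w q ℤ.* a q))
  where
  regroup : ∀ x y → + 1 ℤ.+ x ℤ.* + 3 ℤ.+ + 3 ℤ.* y ≡ + 1 ℤ.+ (x ℤ.+ y) ℤ.* + 3
  regroup = ℤ-Solver.solve-∀

-- n = l⁺ − l⁻, where l⁺ and l⁻ collect the digits +1 and −1 of a balanced ternary expansion of n;
-- a last digit −1 before the expansion of m stands for 3m − 1 = 2 + 3(m − 1).
data BalancedTernary : ℕ → ℕ → ℕ → Set where
  []   : BalancedTernary 0 0 0
  0∷_  : ∀ {n l⁺ l⁻} → BalancedTernary n l⁺ l⁻ →
         BalancedTernary (n * 3) (l⁺ * 3) (l⁻ * 3)
  +1∷_ : ∀ {n l⁺ l⁻} → BalancedTernary n l⁺ l⁻ →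
         BalancedTernary (1 + n * 3) (1 + l⁺ * 3) (l⁻ * 3)
  -1∷_ : ∀ {n l⁺ l⁻} → BalancedTernary (suc n) l⁺ l⁻ →
         BalancedTernary (2 + n * 3) (l⁺ * 3) (1 + l⁻ * 3)

N₂Split : ℕ → ℕ → ℕ → Set
N₂Split n l⁺ l⁻ = N₂ l⁺ × N₂ l⁻ × N₂ (l⁺ + l⁻) × n + l⁻ ≡ l⁺

digitwise-+ : ∀ r s x y → (r + x * 3) + (s + y * 3) ≡ (r + s) + (x + y) * 3
digitwise-+ = solve-∀

digitwise-+ˡ : ∀ r x y → (r + x * 3) + y * 3 ≡ r + (x + y) * 3
digitwise-+ˡ = solve-∀

N₂-cons-+ : ∀ (r s t : Digit 3) x y → toℕ r + toℕ s ≡ toℕ t → t ≢ suc (suc zero) →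
            N₂ (x + y) → N₂ ((toℕ r + x * 3) + (toℕ s + y * 3))
N₂-cons-+ r s t x y r+s≡t t≢2 h = subst N₂
  (sym (trans (digitwise-+ (toℕ r) (toℕ s) x y) (cong (_+ (x + y) * 3) r+s≡t)))
  (N₂-cons t (x + y) t≢2 h)

N₂-uncons-+ : ∀ (r s t : Digit 3) x y → toℕ r + toℕ s ≡ toℕ t →
              N₂ ((toℕ r + x * 3) + (toℕ s + y * 3)) → t ≢ suc (suc zero) × N₂ (x + y)
N₂-uncons-+ r s t x y r+s≡t h = N₂-uncons t (x + y)
  (subst N₂ (trans (digitwise-+ (toℕ r) (toℕ s) x y) (cong (_+ (x + y) * 3) r+s≡t)) h)

BalancedTernary⇒N₂Split : ∀ {n l⁺ l⁻} → BalancedTernary n l⁺ l⁻ → N₂Split n l⁺ l⁻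
BalancedTernary⇒N₂Split [] = N₂-0 , N₂-0 , N₂-0 , refl
BalancedTernary⇒N₂Split (0∷_ {n} {l⁺} {l⁻} bt) with BalancedTernary⇒N₂Split bt
... | h⁺ , h⁻ , h± , e =
  N₂-cons zero l⁺ (λ ()) h⁺ , N₂-cons zero l⁻ (λ ()) h⁻ ,
  N₂-cons-+ zero zero zero l⁺ l⁻ refl (λ ()) h± ,
  trans (digitwise-+ 0 0 n l⁻) (cong (_* 3) e)
BalancedTernary⇒N₂Split (+1∷_ {n} {l⁺} {l⁻} bt) with BalancedTernary⇒N₂Split bt
... | h⁺ , h⁻ , h± , e =
  N₂-cons (suc zero) l⁺ (λ ()) h⁺ , N₂-cons zero l⁻ (λ ()) h⁻ ,
  N₂-cons-+ (suc zero) zero (suc zero) l⁺ l⁻ refl (λ ()) h± ,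
  trans (digitwise-+ 1 0 n l⁻) (cong (λ m → 1 + m * 3) e)
BalancedTernary⇒N₂Split (-1∷_ {n} {l⁺} {l⁻} bt) with BalancedTernary⇒N₂Split bt
... | h⁺ , h⁻ , h± , e =
  N₂-cons zero l⁺ (λ ()) h⁺ , N₂-cons (suc zero) l⁻ (λ ()) h⁻ ,
  N₂-cons-+ zero (suc zero) (suc zero) l⁺ l⁻ refl (λ ()) h± ,
  trans (digitwise-+ 2 1 n l⁻) (cong (_* 3) e)

balancedTernary : ∀ n → Acc _<_ n → Σ ℕ λ l⁺ → Σ ℕ λ l⁻ → BalancedTernary n l⁺ l⁻
balancedTernary n (acc rec) with lastDigit n
... | zero ∷ᵗ zero = 0 , 0 , []
... | zero ∷ᵗ suc q =
  let l⁺ , l⁻ , bt = balancedTernary (suc q) (rec (1+q<d+[1+q]*3 zero q)) in l⁺ * 3 , l⁻ * 3 , 0∷ bt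
... | suc zero ∷ᵗ q =
  let l⁺ , l⁻ , bt = balancedTernary q (rec (q<1+q*3 q)) in 1 + l⁺ * 3 , l⁻ * 3 , +1∷ bt
... | suc (suc zero) ∷ᵗ q =
  let l⁺ , l⁻ , bt = balancedTernary (suc q) (rec (s≤s (q<1+q*3 q))) in l⁺ * 3 , 1 + l⁻ * 3 , -1∷ bt

N₂Split⇒BalancedTernary-0 : ∀ {n l⁻} → N₂Split n 0 l⁻ → BalancedTernary n 0 l⁻
N₂Split⇒BalancedTernary-0 {n} (_ , _ , _ , e) with m+n≡0⇒m≡0 n e | m+n≡0⇒n≡0 n e
... | refl | refl = []

N₂Split-tail : ∀ (r s t : Digit 3) {m x y} → toℕ r + toℕ s ≡ toℕ t →
               N₂ (toℕ r + x * 3) → N₂ (toℕ s + y * 3) →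
               N₂ ((toℕ r + x * 3) + (toℕ s + y * 3)) →
               m + y ≡ x → N₂Split m x y
N₂Split-tail r s t {x = x} {y} r+s≡t h⁺ h⁻ h± e =
  proj₂ (N₂-uncons r x h⁺) , proj₂ (N₂-uncons s y h⁻) ,
  proj₂ (N₂-uncons-+ r s t x y r+s≡t h±) , e

mutual
  N₂Split⇒BalancedTernary : ∀ {n l⁺ l⁻} → Acc _<_ l⁺ →
                            N₂Split n l⁺ l⁻ → BalancedTernary n l⁺ l⁻
  N₂Split⇒BalancedTernary {n} {l⁺} {l⁻} acc-l⁺ split
    with lastDigit n | lastDigit l⁺ | lastDigit l⁻
  ... | dn ∷ᵗ q | d⁺ ∷ᵗ q⁺ | d⁻ ∷ᵗ q⁻ = byLastDigits dn d⁺ d⁻ {q} {q⁺} {q⁻} acc-l⁺ split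

  byLastDigits : ∀ (dn d⁺ d⁻ : Digit 3) {q q⁺ q⁻} → Acc _<_ (toℕ d⁺ + q⁺ * 3) →
                 N₂Split (toℕ dn + q * 3) (toℕ d⁺ + q⁺ * 3) (toℕ d⁻ + q⁻ * 3) →
                 BalancedTernary (toℕ dn + q * 3) (toℕ d⁺ + q⁺ * 3) (toℕ d⁻ + q⁻ * 3)
  byLastDigits _ (suc (suc zero)) _ {q⁺ = q⁺} _ (h⁺ , _) =
    ⊥-elim (proj₁ (N₂-uncons _ q⁺ h⁺) refl)
  byLastDigits _ _ (suc (suc zero)) {q⁻ = q⁻} _ (_ , h⁻ , _) =
    ⊥-elim (proj₁ (N₂-uncons _ q⁻ h⁻) refl)
  byLastDigits _ (suc zero) (suc zero) {q⁺ = q⁺} {q⁻} _ (_ , _ , h± , _) =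
    ⊥-elim (proj₁ (N₂-uncons-+ (suc zero) (suc zero) (suc (suc zero)) q⁺ q⁻ refl h±) refl)
  byLastDigits dn zero zero {q} {q⁺} {q⁻} acc-l⁺ (h⁺ , h⁻ , h± , e)
    with divMod-unique dn zero (q + q⁻) q⁺ (trans (sym (digitwise-+ˡ (toℕ dn) q q⁻)) e)
  ... | refl , e′ =
    0∷ byQuotient zero acc-l⁺ (N₂Split-tail zero zero zero {q} refl h⁺ h⁻ h± e′)
  byLastDigits dn (suc zero) zero {q} {q⁺} {q⁻} acc-l⁺ (h⁺ , h⁻ , h± , e)
    with divMod-unique dn (suc zero) (q + q⁻) q⁺ (trans (sym (digitwise-+ˡ (toℕ dn) q q⁻)) e)
  ... | refl , e′ =
    +1∷ byQuotient (suc zero) acc-l⁺ (N₂Split-tail (suc zero) zero (suc zero) {q} refl h⁺ h⁻ h± e′)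
  byLastDigits zero zero (suc zero) {q} {q⁺} {q⁻} _ (_ , _ , _ , e)
    with divMod-unique (suc zero) zero (q + q⁻) q⁺ (trans (sym (digitwise-+ 0 1 q q⁻)) e)
  ... | () , _
  byLastDigits (suc zero) zero (suc zero) {q} {q⁺} {q⁻} _ (_ , _ , _ , e)
    with divMod-unique (suc (suc zero)) zero (q + q⁻) q⁺ (trans (sym (digitwise-+ 1 1 q q⁻)) e)
  ... | () , _
  byLastDigits (suc (suc zero)) zero (suc zero) {q} {q⁺} {q⁻} acc-l⁺ (h⁺ , h⁻ , h± , e) =
    -1∷ byQuotient zero acc-l⁺ (N₂Split-tail zero (suc zero) (suc zero) {suc q} refl h⁺ h⁻ h± e′)
    where
    e′ : suc q + q⁻ ≡ q⁺
    e′ = *-cancelʳ-≡ _ _ 3 (trans (sym (digitwise-+ 2 1 q q⁻)) e)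

  byQuotient : ∀ (d : Digit 3) {m q y} → Acc _<_ (toℕ d + q * 3) →
               N₂Split m q y → BalancedTernary m q y
  byQuotient _ {q = zero}  _         = N₂Split⇒BalancedTernary-0
  byQuotient d {q = suc q} (acc rec) = N₂Split⇒BalancedTernary (rec (1+q<d+[1+q]*3 d q))

pos-[x+y]*3 : ∀ x y → + (x + y) ℤ.* + 3 ≡ + (x * 3 + y * 3)
pos-[x+y]*3 x y = trans (sym (pos-* (x + y) 3)) (cong +_ (*-distribʳ-+ 3 x y))

p-BalancedTernary : ∀ {n l⁺ l⁻} → BalancedTernary n l⁺ l⁻ → p n ≡ + (l⁺ + l⁻)
p-BalancedTernary [] = refl
p-BalancedTernary (0∷_ {n} {l⁺} {l⁻} bt) = begin
  p (n * 3)             ≡⟨ p-×3 n ⟩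
  p n ℤ.* + 3           ≡⟨ cong (ℤ._* + 3) (p-BalancedTernary bt) ⟩
  + (l⁺ + l⁻) ℤ.* + 3   ≡⟨ pos-[x+y]*3 l⁺ l⁻ ⟩
  + (l⁺ * 3 + l⁻ * 3)   ∎
  where open ≡-Reasoning
p-BalancedTernary (+1∷_ {n} {l⁺} {l⁻} bt) = begin
  p (1 + n * 3)                   ≡⟨ p-×3+1 n ⟩
  + 1 ℤ.+ p n ℤ.* + 3             ≡⟨ cong (λ z → + 1 ℤ.+ z ℤ.* + 3) (p-BalancedTernary bt) ⟩
  + 1 ℤ.+ + (l⁺ + l⁻) ℤ.* + 3     ≡⟨ cong (ℤ._+_ (+ 1)) (pos-[x+y]*3 l⁺ l⁻) ⟩
  + ((1 + l⁺ * 3) + l⁻ * 3)       ∎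
  where open ≡-Reasoning
p-BalancedTernary (-1∷_ {n} {l⁺} {l⁻} bt) = begin
  p (2 + n * 3)                   ≡⟨ p-×3+2 n ⟩
  + 1 ℤ.+ p (suc n) ℤ.* + 3       ≡⟨ cong (λ z → + 1 ℤ.+ z ℤ.* + 3) (p-BalancedTernary bt) ⟩
  + 1 ℤ.+ + (l⁺ + l⁻) ℤ.* + 3     ≡⟨ cong (ℤ._+_ (+ 1)) (pos-[x+y]*3 l⁺ l⁻) ⟩
  + (1 + (l⁺ * 3 + l⁻ * 3))       ≡⟨ cong +_ (+-suc (l⁺ * 3) (l⁻ * 3)) ⟨
  + (l⁺ * 3 + (1 + l⁻ * 3))       ∎
  where open ≡-Reasoning

mainTheorem5 : (n : ℕ) →
    Σ ℕ (λ l⁺ → Σ ℕ (λ l⁻ → N₂ l⁺ × N₂ l⁻ × N₂ (l⁺ + l⁻) × n + l⁻ ≡ l⁺))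
    × ((l⁺ l⁻ : ℕ) → N₂ l⁺ → N₂ l⁻ → N₂ (l⁺ + l⁻) → n + l⁻ ≡ l⁺ →
        p n ≡ + (l⁺ + l⁻))
mainTheorem5 n = existence , value
  where
  existence : Σ ℕ λ l⁺ → Σ ℕ λ l⁻ → N₂Split n l⁺ l⁻
  existence = let l⁺ , l⁻ , bt = balancedTernary n (<-wellFounded n)
              in l⁺ , l⁻ , BalancedTernary⇒N₂Split bt

  value : ∀ l⁺ l⁻ → N₂ l⁺ → N₂ l⁻ → N₂ (l⁺ + l⁻) → n + l⁻ ≡ l⁺ → p n ≡ + (l⁺ + l⁻)
  value l⁺ l⁻ h⁺ h⁻ h± e =
    p-BalancedTernary (N₂Split⇒BalancedTernary (<-wellFounded l⁺) (h⁺ , h⁻ , h± , e))
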